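{- For every integer $d\ge 2$, the chromatic number of the Keller graph is $\chi(G_d)=2^d$.
   Context: The Keller graph $G_d$ has as vertices the $4^d$ tuples in $\{0,1,2,3\}^d$; two tuples $u,v$ are adjacent iff they differ in at least two coordinates and there is at least one coordinate $i$ with $u_i-v_i\equiv 2\pmod 4$. -}

module Defs where

open import Data.Nat using (ℕ; zero; suc; _+_; _≤_; _%_)
open import Data.Fin using (Fin; toℕ)
import Data.Fin as F
open import Data.Fin.Properties using (_≟_)
open import Data.Product using (Σ; ∃; _×_)
open import Relation.Nullary using (¬_; yes; no)
open import Relation.Binary.PropositionalEquality using (_≡_)

Vertex : ℕ → Set
Vertex d = Fin d → Fin 4

hamming : ∀ {d} → Vertex d → Vertex d → ℕ
hamming {zero}  u v = 0
hamming {suc d} u v with u F.zero ≟ v F.zero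
... | yes _ = hamming (λ i → u (F.suc i)) (λ i → v (F.suc i))
... | no  _ = suc (hamming (λ i → u (F.suc i)) (λ i → v (F.suc i)))

-- u_i - v_i ≡ 2 (mod 4), i.e. v_i ≡ u_i + 2 (mod 4) (symmetric relation).
DiffTwo : Fin 4 → Fin 4 → Set
DiffTwo a b = (toℕ a + 2) % 4 ≡ toℕ b

KellerAdj : (d : ℕ) → Vertex d → Vertex d → Set
KellerAdj d u v = (2 ≤ hamming u v) × ∃ (λ i → DiffTwo (u i) (v i))

ProperColouring : (d k : ℕ) → (Vertex d → Fin k) → Set
ProperColouring d k c = ∀ u v → KellerAdj d u v → ¬ (c u ≡ c v)

Colourable : (d k : ℕ) → Set
Colourable d k = Σ (Vertex d → Fin k) (ProperColouring d k)

ChromaticNumber : (d k : ℕ) → Set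
ChromaticNumber d k = Colourable d k × (∀ m → Colourable d m → k ≤ m)

-- Upper bound: colour a vertex by the vector of "halves" of its coordinates ({0,1} ↦ 0,
-- {2,3} ↦ 1); adjacent vertices differ by 2 mod 4 somewhere, hence in the half there.
-- Lower bound: χ(G_d) ≥ 4^d / α(G_d), and α(G_d) ≤ 2^d for d ≥ 3.  Split an independent
-- set of G_(d+1) by its first coordinate into four slices, each independent in G_d.
-- Two vertices from the opposite slices j and j+2 differ by 2 in the first coordinate,
-- so their tails must coincide; thus of two opposite slices either one is empty or both
-- are singletons, and each opposite pair contributes at most α(G_d), giving
-- α(G_(d+1)) ≤ 2 α(G_d) as long as α(G_d) ≥ 2.  The base cases α(G_3) ≤ 8 and, for
-- d = 2, α(G_2) ≤ 5 < 16/3 are checked by a verified branch-and-bound search.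
module Submission where

open import Defs
open import Data.Nat using (ℕ; _≤_; _^_)
open import Data.Nat using (zero; suc; _+_; _*_; _%_; _<_; _≤?_; _≤ᵇ_; _≡ᵇ_; z≤n; s≤s; z<s)
open import Data.Nat.Properties hiding (_≟_)
import Data.Nat.ListAction as List
open import Data.Nat.Tactic.RingSolver using (solve-∀)
open import Algebra.Properties.CommutativeMonoid.Sum +-0-commutativeMonoid
  using (sum-syntax; sum-replicate-zero; ∑-distrib-+)
open import Data.Bool using (Bool; true; false; T; _∧_; _∨_; if_then_else_)
open import Data.Bool.Properties using (T-∧; T-∨)
open import Data.Fin as Fin using (Fin; toℕ; funToFin; finToFun)
open import Data.Fin.Patterns using (0F; 1F; 2F; 3F)
open import Data.Fin.Properties using (_≟_; toℕ-injective; finToFun-funToFin)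
open import Data.List using (List; []; _∷_; [_]; _++_; map; length; filter; allFin; cartesianProductWith)
open import Data.List.Properties using (length-++; length-map)
open import Data.Vec.Functional using (tail) renaming (_∷_ to _∷ᵥ_)
open import Data.Product using (∃; _×_; _,_; proj₁; proj₂)
open import Data.Sum using (inj₁; inj₂)
open import Data.Unit using (tt)
open import Function using (_∘_; _$_; Equivalence)
open import Relation.Binary using (Rel)
open import Relation.Nullary using (T?; ¬_; yes; no; does; contradiction; ¬?)
open import Relation.Unary as U using (Pred)
open import Level using (Level)
open import Relation.Binary.PropositionalEquality
  using (_≡_; _≢_; refl; sym; trans; cong; cong₂; subst; module ≡-Reasoning)

private variable
  ℓ : Level
  A B C : Set

-- Summing an indicator (rather than branching with `if`) keeps conversion checking
-- on counts over large, concrete vertex lists linear.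
count : (A → Bool) → List A → ℕ
count P []       = 0
count P (x ∷ xs) = (if P x then 1 else 0) + count P xs

count≤length : ∀ (P : A → Bool) xs → count P xs ≤ length xs
count≤length P []       = z≤n
count≤length P (x ∷ xs) with P x
... | true  = s≤s (count≤length P xs)
... | false = m≤n⇒m≤1+n (count≤length P xs)

count-++ : ∀ (P : A → Bool) xs ys → count P (xs ++ ys) ≡ count P xs + count P ys
count-++ P []       ys = refl
count-++ P (x ∷ xs) ys with P x
... | true  = cong suc (count-++ P xs ys)
... | false = count-++ P xs ys

count-map : ∀ P (f : B → A) xs → count P (map f xs) ≡ count (P ∘ f) xs
count-map P f []       = refl
count-map P f (x ∷ xs) = cong ((if P (f x) then 1 else 0) +_) (count-map P f xs)

count-filter : ∀ {P : A → Bool} {Q : Pred A ℓ} (Q? : U.Decidable Q) →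
  (∀ {x} → T (P x) → Q x) → ∀ xs → count P (filter Q? xs) ≡ count P xs
count-filter Q? P⊆Q [] = refl
count-filter {P = P} Q? P⊆Q (x ∷ xs) with Q? x
... | yes _ = cong ((if P x then 1 else 0) +_) (count-filter Q? P⊆Q xs)
... | no ¬Qx with P x in Px
...   | false = count-filter Q? P⊆Q xs
...   | true  = contradiction (P⊆Q (subst T (sym Px) _)) ¬Qx

count>0⇒∃ : ∀ (P : A → Bool) xs → 0 < count P xs → ∃ λ x → T (P x)
count>0⇒∃ P (x ∷ xs) pos with P x in Px
... | true  = x , subst T (sym Px) _
... | false = count>0⇒∃ P xs pos

length-cartesianProductWith : ∀ (f : A → B → C) xs ys →
  length (cartesianProductWith f xs ys) ≡ length xs * length ys
length-cartesianProductWith f []       ys = refl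
length-cartesianProductWith f (x ∷ xs) ys = begin
  length (map (f x) ys ++ cartesianProductWith f xs ys)
    ≡⟨ length-++ (map (f x) ys) ⟩
  length (map (f x) ys) + length (cartesianProductWith f xs ys)
    ≡⟨ cong₂ _+_ (length-map (f x) ys) (length-cartesianProductWith f xs ys) ⟩
  length ys + length xs * length ys ∎
  where open ≡-Reasoning

count-cartesianProductWith : ∀ (f : A → B → C) P xs ys →
  count P (cartesianProductWith f xs ys) ≡ List.sum (map (λ x → count (P ∘ f x) ys) xs)
count-cartesianProductWith f P []       ys = refl
count-cartesianProductWith f P (x ∷ xs) ys = begin
  count P (map (f x) ys ++ cartesianProductWith f xs ys)
    ≡⟨ count-++ P (map (f x) ys) _ ⟩
  count P (map (f x) ys) + count P (cartesianProductWith f xs ys)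
    ≡⟨ cong₂ _+_ (count-map P (f x) ys) (count-cartesianProductWith f P xs ys) ⟩
  count (P ∘ f x) ys + List.sum (map (λ x → count (P ∘ f x) ys) xs) ∎
  where open ≡-Reasoning

∑-mono-≤ : ∀ {m} {f g : Fin m → ℕ} → (∀ k → f k ≤ g k) → ∑[ k < m ] f k ≤ ∑[ k < m ] g k
∑-mono-≤ {zero}  f≤g = z≤n
∑-mono-≤ {suc m} f≤g = +-mono-≤ (f≤g 0F) (∑-mono-≤ (f≤g ∘ Fin.suc))

∑-≤-* : ∀ {m n} {f : Fin m → ℕ} → (∀ k → f k ≤ n) → ∑[ k < m ] f k ≤ m * n
∑-≤-* {zero}  f≤n = z≤n
∑-≤-* {suc m} f≤n = +-mono-≤ (f≤n 0F) (∑-≤-* (f≤n ∘ Fin.suc))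

∑-indicator : ∀ {m} (i : Fin m) → ∑[ k < m ] (if does (i ≟ k) then 1 else 0) ≡ 1
∑-indicator {suc m} 0F          = cong suc (sum-replicate-zero m)
∑-indicator         (Fin.suc i) = ∑-indicator i

+-≤-zero-or-both-≤1 : ∀ {a b n} → 2 ≤ n → a ≤ n → b ≤ n → (0 < a → 0 < b → a ≤ 1 × b ≤ 1) → a + b ≤ n
+-≤-zero-or-both-≤1 {zero}              _   _   b≤n _    = b≤n
+-≤-zero-or-both-≤1 {suc a} {zero} {n} _   a≤n _   _    = subst (_≤ n) (sym (+-identityʳ (suc a))) a≤n
+-≤-zero-or-both-≤1 {suc a} {suc b}     2≤n _   _   both =
  let (a≤1 , b≤1) = both z<s z<s in ≤-trans (+-mono-≤ a≤1 b≤1) 2≤n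

Independent : Rel A ℓ → (A → Bool) → Set ℓ
Independent E I = ∀ {u v} → T (I u) → T (I v) → ¬ E u v

colourClass : ∀ {m} → (A → Fin m) → Fin m → A → Bool
colourClass c k v = does (c v ≟ k)

∑-count-colourClass : ∀ {m} (c : A → Fin m) xs → ∑[ k < m ] count (colourClass c k) xs ≡ length xs
∑-count-colourClass {m = m} c []       = sum-replicate-zero m
∑-count-colourClass {m = m} c (x ∷ xs) = begin
  ∑[ k < m ] ((if does (c x ≟ k) then 1 else 0) + count (colourClass c k) xs)
    ≡⟨ ∑-distrib-+ (λ k → if does (c x ≟ k) then 1 else 0) (λ k → count (colourClass c k) xs) ⟩
  ∑[ k < m ] (if does (c x ≟ k) then 1 else 0) + ∑[ k < m ] count (colourClass c k) xs
    ≡⟨ cong₂ _+_ (∑-indicator (c x)) (∑-count-colourClass c xs) ⟩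
  suc (length xs) ∎
  where open ≡-Reasoning

colourClass-independent : ∀ {E : Rel A ℓ} {m} {c : A → Fin m} →
  (∀ u v → E u v → c u ≢ c v) → ∀ k → Independent E (colourClass c k)
colourClass-independent {c = c} proper k {u} {v} u∈k v∈k uv with c u ≟ k | c v ≟ k
... | yes cu≡k | yes cv≡k = proper u v uv (trans cu≡k (sym cv≡k))
... | no _     | _        = u∈k
... | yes _    | no _     = v∈k

length≤colours*bound : ∀ {E : Rel A ℓ} {m n} (c : A → Fin m) → (∀ u v → E u v → c u ≢ c v) →
  ∀ xs → (∀ I → Independent E I → count I xs ≤ n) → length xs ≤ m * n
length≤colours*bound c proper xs bound =
  subst (_≤ _) (∑-count-colourClass c xs) (∑-≤-* λ k → bound _ (colourClass-independent proper k))

module _ (adjacentᵇ : A → A → Bool) (bound : ℕ) where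

  nonNeighbours : A → List A → List A
  nonNeighbours v = filter (λ w → ¬? (T? (adjacentᵇ v w)))

  independenceBoundᵇ : (fuel n : ℕ) → List A → Bool
  independenceBoundᵇ fuel n xs with n + length xs ≤? bound
  ... | yes _ = true
  independenceBoundᵇ zero       n xs       | no _ = false
  independenceBoundᵇ (suc fuel) n []       | no _ = false
  independenceBoundᵇ (suc fuel) n (v ∷ xs) | no _ =
    independenceBoundᵇ fuel n xs ∧ independenceBoundᵇ fuel (suc n) (nonNeighbours v xs)

  independenceBoundᵇ-sound : ∀ {E : Rel A ℓ} → (∀ {u v} → T (adjacentᵇ u v) → E u v) →
    ∀ {I} → Independent E I → ∀ fuel n xs →
    T (independenceBoundᵇ fuel n xs) → n + count I xs ≤ bound
  independenceBoundᵇ-sound sound {I} ind fuel n xs ok with n + length xs ≤? bound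
  ... | yes fits = ≤-trans (+-monoʳ-≤ n (count≤length I xs)) fits
  independenceBoundᵇ-sound sound ind zero       n xs       () | no _
  independenceBoundᵇ-sound sound ind (suc fuel) n []       () | no _
  independenceBoundᵇ-sound sound {I} ind (suc fuel) n (v ∷ xs) ok | no _ with I v in Iv
  ... | false = independenceBoundᵇ-sound sound ind fuel n xs (proj₁ (Equivalence.to T-∧ ok))
  ... | true  = begin
    n + suc (count I xs)                 ≡⟨ +-suc n _ ⟩
    suc n + count I xs                   ≡⟨ cong (suc n +_) (count-filter _ notAdjacent xs) ⟨
    suc n + count I (nonNeighbours v xs) ≤⟨ independenceBoundᵇ-sound sound ind fuel (suc n) _ withV ⟩
    bound                                ∎
    where
    open ≤-Reasoning
    withV : T (independenceBoundᵇ fuel (suc n) (nonNeighbours v xs))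
    withV = proj₂ (Equivalence.to T-∧ ok)
    notAdjacent : ∀ {w} → T (I w) → ¬ T (adjacentᵇ v w)
    notAdjacent Iw = ind (subst T (sym Iv) _) Iw ∘ sound

vertices : ∀ d → List (Vertex d)
vertices zero    = [ (λ ()) ]
vertices (suc d) = cartesianProductWith _∷ᵥ_ (allFin 4) (vertices d)

length-vertices : ∀ d → length (vertices d) ≡ 4 ^ d
length-vertices zero    = refl
length-vertices (suc d) =
  trans (length-cartesianProductWith _∷ᵥ_ (allFin 4) (vertices d)) (cong (4 *_) (length-vertices d))

slice : ∀ {d} → (Vertex (suc d) → Bool) → Fin 4 → Vertex d → Bool
slice P j x = P (j ∷ᵥ x)

count-vertices-suc : ∀ {d} (P : Vertex (suc d) → Bool) →
  count P (vertices (suc d)) ≡ ∑[ j < 4 ] count (slice P j) (vertices d)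
count-vertices-suc {d} P = count-cartesianProductWith _∷ᵥ_ P (allFin 4) (vertices d)

DiffTwoᵇ : Fin 4 → Fin 4 → Bool
DiffTwoᵇ a b = (toℕ a + 2) % 4 ≡ᵇ toℕ b

anyDiffTwoᵇ : ∀ {d} → Vertex d → Vertex d → Bool
anyDiffTwoᵇ {zero}  _ _ = false
anyDiffTwoᵇ {suc d} u v = DiffTwoᵇ (u 0F) (v 0F) ∨ anyDiffTwoᵇ (tail u) (tail v)

anyDiffTwoᵇ-sound : ∀ {d} (u v : Vertex d) → T (anyDiffTwoᵇ u v) → ∃ λ i → DiffTwo (u i) (v i)
anyDiffTwoᵇ-sound {suc d} u v ok with Equivalence.to T-∨ ok
... | inj₁ here  = 0F , ≡ᵇ⇒≡ _ _ here
... | inj₂ there = let (i , diff) = anyDiffTwoᵇ-sound (tail u) (tail v) there in Fin.suc i , diff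

KellerAdjᵇ : ∀ d → Vertex d → Vertex d → Bool
KellerAdjᵇ d u v = (2 ≤ᵇ hamming u v) ∧ anyDiffTwoᵇ u v

KellerAdjᵇ-sound : ∀ {d u v} → T (KellerAdjᵇ d u v) → KellerAdj d u v
KellerAdjᵇ-sound {u = u} {v} ok =
  let (far , diff) = Equivalence.to T-∧ ok in ≤ᵇ⇒≤ 2 (hamming u v) far , anyDiffTwoᵇ-sound u v diff

hamming-head≡ : ∀ {d} (u v : Vertex (suc d)) → u 0F ≡ v 0F → hamming u v ≡ hamming (tail u) (tail v)
hamming-head≡ u v u₀≡v₀ with u 0F ≟ v 0F
... | yes _      = refl
... | no  u₀≢v₀  = contradiction u₀≡v₀ u₀≢v₀

hamming-head≢ : ∀ {d} (u v : Vertex (suc d)) → u 0F ≢ v 0F → hamming u v ≡ suc (hamming (tail u) (tail v))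
hamming-head≢ u v u₀≢v₀ with u 0F ≟ v 0F
... | yes u₀≡v₀ = contradiction u₀≡v₀ u₀≢v₀
... | no  _     = refl

half : Fin 4 → Fin 2
half 0F = 0F
half 1F = 0F
half 2F = 1F
half 3F = 1F

opposite : Fin 4 → Fin 4
opposite 0F = 2F
opposite 1F = 3F
opposite 2F = 0F
opposite 3F = 1F

DiffTwo⇒opposite : ∀ {a b} → DiffTwo a b → b ≡ opposite a
DiffTwo⇒opposite {0F} diff = toℕ-injective (sym diff)
DiffTwo⇒opposite {1F} diff = toℕ-injective (sym diff)
DiffTwo⇒opposite {2F} diff = toℕ-injective (sym diff)
DiffTwo⇒opposite {3F} diff = toℕ-injective (sym diff)

half≢half-opposite : ∀ a → half a ≢ half (opposite a)
half≢half-opposite 0F ()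
half≢half-opposite 1F ()
half≢half-opposite 2F ()
half≢half-opposite 3F ()

DiffTwo⇒half≢ : ∀ {a b} → DiffTwo a b → half a ≢ half b
DiffTwo⇒half≢ {a} diff same = half≢half-opposite a (trans same (cong half (DiffTwo⇒opposite diff)))

DiffTwo⇒≢ : ∀ {a b} → DiffTwo a b → a ≢ b
DiffTwo⇒≢ diff refl = DiffTwo⇒half≢ diff refl

halfColouring : ∀ d → Vertex d → Fin (2 ^ d)
halfColouring d v = funToFin (half ∘ v)

halfColouring-proper : ∀ d → ProperColouring d (2 ^ d) (halfColouring d)
halfColouring-proper d u v (_ , i , diff) same = DiffTwo⇒half≢ diff $ begin
  half (u i)                     ≡⟨ finToFun-funToFin (half ∘ u) i ⟨
  finToFun (halfColouring d u) i ≡⟨ cong (λ c → finToFun c i) same ⟩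
  finToFun (halfColouring d v) i ≡⟨ finToFun-funToFin (half ∘ v) i ⟩
  half (v i)                     ∎
  where open ≡-Reasoning

count-vertices-≤1 : ∀ {d} (y : Vertex d) (P : Vertex d → Bool) →
  (∀ {x} → T (P x) → hamming x y ≡ 0) → count P (vertices d) ≤ 1
count-vertices-≤1 {zero}  y P _     = count≤length P (vertices 0)
count-vertices-≤1 {suc d} y P agree = begin
  count P (vertices (suc d))                       ≡⟨ count-vertices-suc P ⟩
  ∑[ j < 4 ] count (slice P j) (vertices d)        ≤⟨ ∑-mono-≤ slice≤ ⟩
  ∑[ j < 4 ] (if does (y 0F ≟ j) then 1 else 0)   ≡⟨ ∑-indicator (y 0F) ⟩
  1                                                ∎
  where
  open ≤-Reasoning
  slice≤ : ∀ j → count (slice P j) (vertices d) ≤ (if does (y 0F ≟ j) then 1 else 0)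
  slice≤ j with y 0F ≟ j
  ... | yes refl = count-vertices-≤1 (tail y) (slice P j) λ {x} x∈ →
    trans (sym (hamming-head≡ (j ∷ᵥ x) y refl)) (agree x∈)
  ... | no  y₀≢j = ≮⇒≥ λ nonempty →
    let (x , x∈) = count>0⇒∃ (slice P j) (vertices d) nonempty
    in  0≢1+n (trans (sym (agree x∈)) (hamming-head≢ (j ∷ᵥ x) y (y₀≢j ∘ sym)))

IndependenceBound : ℕ → ℕ → Set
IndependenceBound d n = ∀ I → Independent (KellerAdj d) I → count I (vertices d) ≤ n

module _ {d} {I : Vertex (suc d) → Bool} (ind : Independent (KellerAdj (suc d)) I) where

  slice-independent : ∀ j → Independent (KellerAdj d) (slice I j)
  slice-independent j {x} {y} x∈ y∈ (far , i , diff) =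
    ind x∈ y∈ (subst (2 ≤_) (sym (hamming-head≡ (j ∷ᵥ x) (j ∷ᵥ y) refl)) far , Fin.suc i , diff)

  opposite-slices-agree : ∀ {j k x y} → DiffTwo j k → T (slice I j x) → T (slice I k y) → hamming x y ≡ 0
  opposite-slices-agree {j} {k} {x} {y} diff x∈ y∈ with hamming x y in distance
  ... | zero  = refl
  ... | suc _ = contradiction (far , 0F , diff) (ind x∈ y∈)
    where
    far : 2 ≤ hamming (j ∷ᵥ x) (k ∷ᵥ y)
    far = subst (2 ≤_) (sym (trans (hamming-head≢ (j ∷ᵥ x) (k ∷ᵥ y) (DiffTwo⇒≢ diff)) (cong suc distance)))
                (s≤s (s≤s z≤n))

  opposite-slices-≤ : ∀ {n} → 2 ≤ n → IndependenceBound d n → ∀ {j k} → DiffTwo j k → DiffTwo k j →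
    count (slice I j) (vertices d) + count (slice I k) (vertices d) ≤ n
  opposite-slices-≤ 2≤n α {j} {k} diff diff′ =
    +-≤-zero-or-both-≤1 2≤n (α _ (slice-independent j)) (α _ (slice-independent k)) singletons
    where
    singletons : 0 < count (slice I j) (vertices d) → 0 < count (slice I k) (vertices d) →
                 count (slice I j) (vertices d) ≤ 1 × count (slice I k) (vertices d) ≤ 1
    singletons nonemptyʲ nonemptyᵏ =
      let (x , x∈) = count>0⇒∃ _ (vertices d) nonemptyʲ
          (y , y∈) = count>0⇒∃ _ (vertices d) nonemptyᵏ
      in  count-vertices-≤1 y _ (λ x′∈ → opposite-slices-agree diff x′∈ y∈)
        , count-vertices-≤1 x _ (λ y′∈ → opposite-slices-agree diff′ y′∈ x∈)

independenceBound-double : ∀ {d n} → 2 ≤ n → IndependenceBound d n → IndependenceBound (suc d) (2 * n)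
independenceBound-double {d} {n} 2≤n α I ind = begin
  count I (vertices (suc d))          ≡⟨ count-vertices-suc I ⟩
  s 0F + (s 1F + (s 2F + (s 3F + 0))) ≡⟨ regroup (s 0F) (s 1F) (s 2F) (s 3F) ⟩
  (s 0F + s 2F) + (s 1F + s 3F)       ≤⟨ +-mono-≤ (opposite-pair refl refl) (opposite-pair refl refl) ⟩
  n + n                               ≡⟨ cong (n +_) (+-identityʳ n) ⟨
  2 * n                               ∎
  where
  open ≤-Reasoning
  s : Fin 4 → ℕ
  s j = count (slice I j) (vertices d)
  opposite-pair : ∀ {j k} → DiffTwo j k → DiffTwo k j → s j + s k ≤ n
  opposite-pair = opposite-slices-≤ ind 2≤n α
  regroup : ∀ a b c e → a + (b + (c + (e + 0))) ≡ (a + c) + (b + e)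
  regroup = solve-∀

independenceBound-search : ∀ d n →
  T (independenceBoundᵇ (KellerAdjᵇ d) n (length (vertices d)) 0 (vertices d)) → IndependenceBound d n
independenceBound-search d n ok I ind =
  independenceBoundᵇ-sound (KellerAdjᵇ d) n KellerAdjᵇ-sound ind (length (vertices d)) 0 (vertices d) ok

independenceBound-2 : IndependenceBound 2 5
independenceBound-2 = independenceBound-search 2 5 tt

independenceBound-3 : IndependenceBound 3 8
independenceBound-3 = independenceBound-search 3 8 tt

independenceBound-≥3 : ∀ k → IndependenceBound (3 + k) (2 ^ (3 + k))
independenceBound-≥3 zero    = independenceBound-3
independenceBound-≥3 (suc k) =
  independenceBound-double (^-monoʳ-≤ 2 {1} {3 + k} (s≤s z≤n)) (independenceBound-≥3 k)

4^d≤colours*bound : ∀ {d m n} → Colourable d m → IndependenceBound d n → 4 ^ d ≤ m * n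
4^d≤colours*bound {d} (c , proper) α =
  subst (_≤ _) (length-vertices d) (length≤colours*bound c proper (vertices d) α)

4^≡2^*2^ : ∀ d → 4 ^ d ≡ 2 ^ d * 2 ^ d
4^≡2^*2^ d = begin
  4 ^ d             ≡⟨ ^-*-assoc 2 2 d ⟩
  2 ^ (d + (d + 0)) ≡⟨ cong (λ e → 2 ^ (d + e)) (+-identityʳ d) ⟩
  2 ^ (d + d)       ≡⟨ ^-distribˡ-+-* 2 d d ⟩
  2 ^ d * 2 ^ d     ∎
  where open ≡-Reasoning

corollary20 : ∀ (d : ℕ) → 2 ≤ d → ChromaticNumber d (2 ^ d)
corollary20 d 2≤d = (halfColouring d , halfColouring-proper d) , 2^d≤colours d 2≤d
  where
  2^d≤colours : ∀ d → 2 ≤ d → ∀ m → Colourable d m → 2 ^ d ≤ m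
  2^d≤colours 1 (s≤s ())
  2^d≤colours 2 _ m col =
    *-cancelʳ-< 5 3 m (<-≤-trans ≤-refl (4^d≤colours*bound col independenceBound-2))
  2^d≤colours d@(suc (suc (suc k))) _ m col = *-cancelʳ-≤ (2 ^ d) m (2 ^ d) {{m^n≢0 2 d}}
    (subst (_≤ m * 2 ^ d) (4^≡2^*2^ d) (4^d≤colours*bound col (independenceBound-≥3 k)))
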